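{- Let $H$ be the graph with vertex set $\{x,u,v\}\cup\{x_i:1\leqslant i\leqslant 7\}$ (ten distinct vertices) and edge set $\{uv,vx,vx_1,vx_2,vx_3,vx_4,ux_5,ux_6,ux_7\}\cup\{xx_i:1\leqslant i\leqslant 7\}$. Then the augmented cube $AQ_n$ has no subgraph isomorphic to $H$.
   Context: The $n$-dimensional augmented cube $AQ_n$ has as vertices all $n$-bit binary strings $a_na_{n-1}\ldots a_1$. $AQ_1=K_2$. For $n\geqslant 2$, $AQ_n$ is obtained from two copies $AQ^0_{n-1}$ (vertices $0a_{n-1}\ldots a_1$) and $AQ^1_{n-1}$ (vertices $1b_{n-1}\ldots b_1$) of $AQ_{n-1}$ by joining $0a_{n-1}\ldots a_1$ to $1b_{n-1}\ldots b_1$ iff either $a_i=b_i$ for all $1\leqslant i\leqslant n-1$ or $a_i=1-b_i$ for all $1\leqslant i\leqslant n-1$. Equivalently, for $u=u_n\ldots u_1$, writing $u^i$ for $u$ with bit $i$ flipped and $\overline{u}^i$ for $u$ with bits $1,\ldots,i$ all flipped, $N_{AQ_n}(u)=\{u^i:1\leqslant i\leqslant n\}\cup\{\overline{u}^i:2\leqslant i\leqslant n\}$. -}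

module Defs where

open import Data.Nat using (ℕ)
open import Data.Bool using (Bool; not)
open import Data.Vec using (Vec; []; _∷_; map)
open import Data.Product using (_×_; Σ)
open import Data.Sum using (_⊎_)
open import Data.Empty using (⊥)
open import Relation.Binary.PropositionalEquality using (_≡_; _≢_)
open import Relation.Nullary using (¬_)
open import Function.Definitions using (Injective)

-- Vertices of AQ_n: n-bit strings a_n a_{n-1} ... a_1, stored with the
-- most significant bit a_n at the head of the vector.
-- Adjacency follows the recursive definition: AQ_n consists of the two
-- copies 0·AQ_{n-1} and 1·AQ_{n-1}; inside a copy the edges are those of
-- AQ_{n-1}; across copies 0a is joined to 1b iff a = b or a = complement b.
-- With AQ-adj [] [] = ⊥ this yields AQ_1 = K_2 as the base case.
AQ-adj : {n : ℕ} → Vec Bool n → Vec Bool n → Set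
AQ-adj [] [] = ⊥
AQ-adj (a ∷ as) (b ∷ bs) =
  (a ≡ b × AQ-adj as bs) ⊎ (a ≢ b × (as ≡ bs ⊎ as ≡ map not bs))

data HV : Set where
  x u v x₁ x₂ x₃ x₄ x₅ x₆ x₇ : HV

data HEdge : HV → HV → Set where
  uv : HEdge u v
  vx : HEdge v x
  vx₁ : HEdge v x₁
  vx₂ : HEdge v x₂
  vx₃ : HEdge v x₃
  vx₄ : HEdge v x₄
  ux₅ : HEdge u x₅
  ux₆ : HEdge u x₆
  ux₇ : HEdge u x₇
  xx₁ : HEdge x x₁
  xx₂ : HEdge x x₂
  xx₃ : HEdge x x₃
  xx₄ : HEdge x x₄
  xx₅ : HEdge x x₅
  xx₆ : HEdge x x₆
  xx₇ : HEdge x x₇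

-- G has a subgraph isomorphic to H: an injective vertex map sending every
-- edge of H to an edge of G (AQ-adj is symmetric, so orientation is irrelevant).
HasSubgraphH : (n : ℕ) → Set
HasSubgraphH n =
  Σ (HV → Vec Bool n) λ f →
    Injective _≡_ _≡_ f × (∀ {a b} → HEdge a b → AQ-adj (f a) (f b))

{-# OPTIONS --safe #-}
-- Translating f x to the origin, AQ_n becomes the Cayley graph of (ℤ/2)ⁿ generated by the
-- vectors 0…010…0 and 0…01…1, so every neighbour of x is sent to a generator. Two distinct
-- vertices of AQ_n have at most four common neighbours. Hence x₁, …, x₄ are all the common
-- neighbours of x and v, so none of u, x₅, x₆, x₇ is one, and v, x₅, x₆, x₇ are all the common
-- neighbours of x and u. That set is closed under the fixed-point-free involution s ↦ s ⊕ u, so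
-- two of x₅, x₆, x₇, say q and r, satisfy q ⊕ r = u. Then v, q, r and v ⊕ q ⊕ r = v ⊕ u are four
-- generators no two of which are equal or differ by a generator, and comparing leading bits
-- shows that no such quadruple exists.
module Submission where

open import Defs
open import Data.Nat using (ℕ; _≤_; suc)
open import Data.Nat.Properties using (≮⇒≥; 1+n≰n)
open import Data.Fin.Properties using (pigeonhole; <⇒≢)
open import Data.Bool using (Bool; true; false; not; _xor_)
open import Data.Bool.Properties
  using (xor-assoc; xor-comm; xor-identityˡ; xor-identityʳ; xor-same; xor-inverseˡ)
  renaming (_≟_ to _≟ᵇ_)
open import Data.Vec using (Vec; []; _∷_; map; zipWith; replicate; lookup)
open import Data.Vec.Properties
  using (zipWith-assoc; zipWith-comm; zipWith-identityˡ; zipWith-identityʳ; zipWith-inverseˡ; ≡-dec)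
open import Data.Vec.Relation.Unary.Any using (Any; here; there)
import Data.Vec.Relation.Unary.Any as Any
import Data.Vec.Relation.Unary.Any.Properties as Any
open import Data.Vec.Relation.Unary.All using (All; []; _∷_)
open import Data.Vec.Relation.Unary.All.Properties using (lookup⁺; lookup⁻)
open import Data.Vec.Relation.Unary.AllPairs.Core using ([]; _∷_)
open import Data.Vec.Relation.Unary.Unique.Propositional using (Unique)
import Data.Vec.Relation.Unary.Unique.Propositional.Properties as Unique
open import Data.Vec.Membership.Propositional using (_∈_)
open import Data.Vec.Membership.Propositional.Properties using (∈-map⁺; ∈-lookup)
import Data.Vec.Membership.DecPropositional as DecMembership
open import Data.Product using (Σ-syntax; _×_; _,_; proj₁)
open import Data.Sum using (_⊎_; inj₁; inj₂)
open import Data.Empty using (⊥)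
open import Function using (_∘_)
open import Function.Definitions using (Injective)
open import Relation.Nullary using (¬_; yes; no; contradiction)
open import Relation.Binary.PropositionalEquality
  using (_≡_; _≢_; refl; sym; trans; cong; cong₂; subst; module ≡-Reasoning)

private variable
  m n : ℕ
  A : Set

zeros ones : Vec Bool m
zeros = replicate _ false
ones  = replicate _ true

infixr 6 _⊕_
_⊕_ : Vec Bool m → Vec Bool m → Vec Bool m
_⊕_ = zipWith _xor_

⊕-assoc : (p q r : Vec Bool m) → (p ⊕ q) ⊕ r ≡ p ⊕ (q ⊕ r)
⊕-assoc = zipWith-assoc xor-assoc

⊕-comm : (p q : Vec Bool m) → p ⊕ q ≡ q ⊕ p
⊕-comm = zipWith-comm xor-comm

⊕-identityˡ : (p : Vec Bool m) → zeros ⊕ p ≡ p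
⊕-identityˡ = zipWith-identityˡ xor-identityˡ

⊕-identityʳ : (p : Vec Bool m) → p ⊕ zeros ≡ p
⊕-identityʳ = zipWith-identityʳ xor-identityʳ

⊕-self : (p : Vec Bool m) → p ⊕ p ≡ zeros
⊕-self []      = refl
⊕-self (b ∷ p) = cong₂ _∷_ (xor-same b) (⊕-self p)

not⊕≡ones : (p : Vec Bool m) → map not p ⊕ p ≡ ones
not⊕≡ones = zipWith-inverseˡ xor-inverseˡ

⊕-cancelˡ : (p q : Vec Bool m) → p ⊕ (p ⊕ q) ≡ q
⊕-cancelˡ p q = begin
  p ⊕ (p ⊕ q) ≡⟨ ⊕-assoc p p q ⟨
  (p ⊕ p) ⊕ q ≡⟨ cong (_⊕ q) (⊕-self p) ⟩
  zeros ⊕ q   ≡⟨ ⊕-identityˡ q ⟩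
  q           ∎
  where open ≡-Reasoning

⊕-cancelʳ : (p q : Vec Bool m) → (q ⊕ p) ⊕ p ≡ q
⊕-cancelʳ p q = trans (⊕-comm (q ⊕ p) p) (trans (cong (p ⊕_) (⊕-comm q p)) (⊕-cancelˡ p q))

⊕-swapˡ : (p q r : Vec Bool m) → p ⊕ (q ⊕ r) ≡ q ⊕ (p ⊕ r)
⊕-swapˡ p q r = begin
  p ⊕ (q ⊕ r) ≡⟨ ⊕-assoc p q r ⟨
  (p ⊕ q) ⊕ r ≡⟨ cong (_⊕ r) (⊕-comm p q) ⟩
  (q ⊕ p) ⊕ r ≡⟨ ⊕-assoc q p r ⟩
  q ⊕ (p ⊕ r) ∎
  where open ≡-Reasoning

⊕-translate : (c p q : Vec Bool m) → (c ⊕ p) ⊕ (c ⊕ q) ≡ p ⊕ q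
⊕-translate c p q = begin
  (c ⊕ p) ⊕ (c ⊕ q) ≡⟨ ⊕-assoc c p (c ⊕ q) ⟩
  c ⊕ (p ⊕ (c ⊕ q)) ≡⟨ cong (c ⊕_) (⊕-swapˡ p c q) ⟩
  c ⊕ (c ⊕ (p ⊕ q)) ≡⟨ ⊕-cancelˡ c (p ⊕ q) ⟩
  p ⊕ q             ∎
  where open ≡-Reasoning

⊕-injectiveˡ : (p : Vec Bool m) {q r : Vec Bool m} → p ⊕ q ≡ p ⊕ r → q ≡ r
⊕-injectiveˡ p {q} {r} eq = trans (sym (⊕-cancelˡ p q)) (trans (cong (p ⊕_) eq) (⊕-cancelˡ p r))

⊕-injectiveʳ : (p : Vec Bool m) {q r : Vec Bool m} → q ⊕ p ≡ r ⊕ p → q ≡ r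
⊕-injectiveʳ p {q} {r} eq = trans (sym (⊕-cancelʳ p q)) (trans (cong (_⊕ p) eq) (⊕-cancelʳ p r))

⊕-moveʳ : {p q r : Vec Bool m} → p ⊕ q ≡ r → p ≡ r ⊕ q
⊕-moveʳ {p = p} {q} refl = sym (⊕-cancelʳ q p)

⊕≡zeros⇒≡ : {p q : Vec Bool m} → p ⊕ q ≡ zeros → p ≡ q
⊕≡zeros⇒≡ {q = q} eq = trans (⊕-moveʳ eq) (⊕-identityˡ q)

Constant : Vec Bool m → Set
Constant s = s ≡ zeros ⊎ s ≡ ones

-- The differences of adjacent vertices of AQ_m: u ⊕ uⁱ and u ⊕ ūⁱ in the paper's notation.
Generator : Vec Bool m → Set
Generator []          = ⊥
Generator (false ∷ s) = Generator s
Generator (true  ∷ s) = Constant s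

AQ-adj⇒Generator : {p q : Vec Bool m} → AQ-adj p q → Generator (p ⊕ q)
AQ-adj⇒Generator {p = []} {[]} ()
AQ-adj⇒Generator {p = true  ∷ p} {true  ∷ q} (inj₁ (_ , adj)) = AQ-adj⇒Generator adj
AQ-adj⇒Generator {p = false ∷ p} {false ∷ q} (inj₁ (_ , adj)) = AQ-adj⇒Generator adj
AQ-adj⇒Generator {p = true  ∷ p} {false ∷ q} (inj₂ (_ , inj₁ refl)) = inj₁ (⊕-self p)
AQ-adj⇒Generator {p = true  ∷ p} {false ∷ q} (inj₂ (_ , inj₂ refl)) = inj₂ (not⊕≡ones q)
AQ-adj⇒Generator {p = false ∷ p} {true  ∷ q} (inj₂ (_ , inj₁ refl)) = inj₁ (⊕-self p)
AQ-adj⇒Generator {p = false ∷ p} {true  ∷ q} (inj₂ (_ , inj₂ refl)) = inj₂ (not⊕≡ones q)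
AQ-adj⇒Generator {p = true  ∷ p} {true  ∷ q} (inj₂ (b≢b , _)) = contradiction refl b≢b
AQ-adj⇒Generator {p = false ∷ p} {false ∷ q} (inj₂ (b≢b , _)) = contradiction refl b≢b

¬Generator-zeros : ¬ Generator (zeros {m})
¬Generator-zeros {suc m} = ¬Generator-zeros {m}

Generator-ones : {t : Vec Bool m} → Generator t → Generator (ones {m})
Generator-ones {t = _ ∷ _} _ = inj₂ refl

Constant-⊕ : {p q : Vec Bool m} → Constant p → Constant q → Constant (p ⊕ q)
Constant-⊕ (inj₁ refl) (inj₁ refl) = inj₁ (⊕-self zeros)
Constant-⊕ (inj₁ refl) (inj₂ refl) = inj₂ (⊕-identityˡ ones)
Constant-⊕ (inj₂ refl) (inj₁ refl) = inj₂ (⊕-identityʳ ones)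
Constant-⊕ (inj₂ refl) (inj₂ refl) = inj₁ (⊕-self ones)

Constant-cancel : {p q : Vec Bool m} → Constant p → Constant (p ⊕ q) → Constant q
Constant-cancel {p = p} {q} cp cpq = subst Constant (⊕-cancelˡ p q) (Constant-⊕ cp cpq)

Constant∧≢zeros⇒≡ones : {s : Vec Bool m} → Constant s → s ≢ zeros → s ≡ ones
Constant∧≢zeros⇒≡ones (inj₁ s≡0) s≢0 = contradiction s≡0 s≢0
Constant∧≢zeros⇒≡ones (inj₂ s≡1) _   = s≡1

CommonNeighbour : Vec Bool m → Vec Bool m → Set
CommonNeighbour w s = Generator s × Generator (s ⊕ w)

CommonNeighbour-⊕ : {w s : Vec Bool m} → CommonNeighbour w s → CommonNeighbour w (s ⊕ w)
CommonNeighbour-⊕ {w = w} {s} (gs , gsw) = gsw , subst Generator (sym (⊕-cancelʳ w s)) gs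

commonNeighbours-ones : {s : Vec Bool (suc m)} → CommonNeighbour ones s →
                        s ≡ true ∷ zeros ⊎ s ≡ false ∷ ones
commonNeighbours-ones {s = true ∷ σ} (inj₁ refl , _) = inj₁ refl
commonNeighbours-ones {m} {true ∷ σ} (inj₂ refl , g) =
  contradiction (subst Generator (⊕-self (ones {m})) g) (¬Generator-zeros {m})
commonNeighbours-ones {s = false ∷ σ} (_ , inj₁ e) = inj₂ (cong (false ∷_) (⊕≡zeros⇒≡ e))
commonNeighbours-ones {m} {false ∷ σ} (g , inj₂ e) =
  contradiction (subst Generator (trans (⊕-moveʳ e) (⊕-self ones)) g) (¬Generator-zeros {m})

commonNeighbour-candidates : (w : Vec Bool m) → w ≢ zeros →
  Σ[ cs ∈ Vec (Vec Bool m) 4 ] (∀ {s} → CommonNeighbour w s → s ∈ cs)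
commonNeighbour-candidates [] w≢0 = contradiction refl w≢0
commonNeighbour-candidates (true ∷ ω) _ =
  (false ∷ ω) ∷ (false ∷ (ones ⊕ ω)) ∷ (true ∷ zeros) ∷ (true ∷ ones) ∷ [] , complete
  where
  complete : ∀ {s} → CommonNeighbour (true ∷ ω) s →
             s ∈ (false ∷ ω) ∷ (false ∷ (ones ⊕ ω)) ∷ (true ∷ zeros) ∷ (true ∷ ones) ∷ []
  complete {false ∷ σ} (_ , inj₁ e) = here (cong (false ∷_) (⊕≡zeros⇒≡ e))
  complete {false ∷ σ} (_ , inj₂ e) = there (here (cong (false ∷_) (⊕-moveʳ e)))
  complete {true  ∷ σ} (inj₁ e , _) = there (there (here (cong (true ∷_) e)))
  complete {true  ∷ σ} (inj₂ e , _) = there (there (there (here (cong (true ∷_) e))))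
commonNeighbour-candidates (false ∷ []) w≢0 = contradiction refl w≢0
commonNeighbour-candidates {suc (suc _)} (false ∷ ω) w≢0 with ≡-dec _≟ᵇ_ ω ones
... | yes refl =
  (true ∷ zeros) ∷ (true ∷ ones) ∷ (false ∷ true ∷ zeros) ∷ (false ∷ false ∷ ones) ∷ [] , complete
  where
  complete : ∀ {s} → CommonNeighbour (false ∷ ones) s →
             s ∈ (true ∷ zeros) ∷ (true ∷ ones) ∷ (false ∷ true ∷ zeros) ∷ (false ∷ false ∷ ones) ∷ []
  complete {true  ∷ σ} (inj₁ e , _) = here (cong (true ∷_) e)
  complete {true  ∷ σ} (inj₂ e , _) = there (here (cong (true ∷_) e))
  complete {false ∷ σ} (gσ , gσ⊕1) with commonNeighbours-ones (gσ , gσ⊕1)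
  ... | inj₁ e = there (there (here (cong (false ∷_) e)))
  ... | inj₂ e = there (there (there (here (cong (false ∷_) e))))
... | no ω≢1 with commonNeighbour-candidates ω (w≢0 ∘ cong (false ∷_))
...   | cs , cs-complete = map (false ∷_) cs , complete
  where
  complete : ∀ {s} → CommonNeighbour (false ∷ ω) s → s ∈ map (false ∷_) cs
  complete {false ∷ σ} c = ∈-map⁺ (false ∷_) (cs-complete c)
  complete {true  ∷ σ} (cσ , cσ⊕ω) with Constant-cancel cσ cσ⊕ω
  ... | inj₁ ω≡0 = contradiction (cong (false ∷_) ω≡0) w≢0
  ... | inj₂ ω≡1 = contradiction ω≡1 ω≢1

unique⊆⇒≤ : {xs : Vec A m} {ys : Vec A n} → Unique xs → All (_∈ ys) xs → m ≤ n
unique⊆⇒≤ {xs = xs} {ys} xs! xs⊆ys = ≮⇒≥ λ n<m →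
  let i , j , i<j , same-index = pigeonhole n<m (Any.index ∘ lookup⁺ xs⊆ys)
      open ≡-Reasoning
  in <⇒≢ i<j (Unique.lookup-injective xs! i j (begin
       lookup xs i                            ≡⟨ Any.lookup-index (lookup⁺ xs⊆ys i) ⟩
       lookup ys (Any.index (lookup⁺ xs⊆ys i)) ≡⟨ cong (lookup ys) same-index ⟩
       lookup ys (Any.index (lookup⁺ xs⊆ys j)) ≡⟨ Any.lookup-index (lookup⁺ xs⊆ys j) ⟨
       lookup xs j                            ∎))

commonNeighbours-saturated : {w : Vec Bool m} → w ≢ zeros →
  {ss : Vec (Vec Bool m) 4} → Unique ss → All (CommonNeighbour w) ss →
  ∀ {t} → CommonNeighbour w t → t ∈ ss
commonNeighbours-saturated {w = w} w≢0 {ss} ss! ss-common {t} t-common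
  with commonNeighbour-candidates w w≢0 | DecMembership._∈?_ (≡-dec _≟ᵇ_) t ss
... | _            | yes t∈ss = t∈ss
... | _ , complete | no  t∉ss =
  contradiction
    (unique⊆⇒≤ t∷ss! (complete t-common ∷ lookup⁻ λ i → complete (lookup⁺ ss-common i)))
    1+n≰n
  where
  t∷ss! : Unique (t ∷ ss)
  t∷ss! = lookup⁻ (λ i t≡sᵢ → t∉ss (subst (_∈ ss) (sym t≡sᵢ) (∈-lookup i ss))) ∷ ss!

Distant : Vec Bool m → Set
Distant s = s ≢ zeros × ¬ Generator s

Distant-tail : {s : Vec Bool m} → Distant (false ∷ s) → Distant s
Distant-tail (s≢0 , ¬gs) = s≢0 ∘ cong (false ∷_) , ¬gs

Constant⇒¬Distant : (t : Vec Bool m) {s : Vec Bool m} → Generator t → Constant s → ¬ Distant s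
Constant⇒¬Distant t gt cs (s≢0 , ¬gs) =
  ¬gs (subst Generator (sym (Constant∧≢zeros⇒≡ones cs s≢0)) (Generator-ones {t = t} gt))

constants-not-pairwise-distinct : {p q r : Vec Bool m} → Constant p → Constant q → Constant r →
                                  p ⊕ q ≢ zeros → p ⊕ r ≢ zeros → q ⊕ r ≢ zeros → ⊥
constants-not-pairwise-distinct {p = p} {q} {r} cp cq cr p⊕q≢0 p⊕r≢0 q⊕r≢0 =
  q⊕r≢0 (trans (cong (_⊕ r) q≡r) (⊕-self r))
  where
  q≡r : q ≡ r
  q≡r = ⊕-injectiveˡ p (trans (Constant∧≢zeros⇒≡ones (Constant-⊕ cp cq) p⊕q≢0)
                              (sym (Constant∧≢zeros⇒≡ones (Constant-⊕ cp cr) p⊕r≢0)))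

-- The leading bits of a, b, c and a ⊕ (b ⊕ c) have even parity. If none is set, recurse on the
-- tails; otherwise two of the four start with 1, and two generators starting with 1 are equal or
-- differ by the generator 0∷ones.
generators-not-pairwise-distant : {a b c : Vec Bool m} →
  Generator a → Generator b → Generator c → Generator (a ⊕ (b ⊕ c)) →
  Distant (a ⊕ b) → Distant (a ⊕ c) → Distant (b ⊕ c) → ⊥
generators-not-pairwise-distant {a = false ∷ α} {false ∷ β} {false ∷ γ} ga gb gc gd dab dac dbc =
  generators-not-pairwise-distant ga gb gc gd (Distant-tail dab) (Distant-tail dac) (Distant-tail dbc)
generators-not-pairwise-distant {a = true ∷ α} {true ∷ β} {false ∷ γ} ga gb gc _ dab _ _ =
  Constant⇒¬Distant γ gc (Constant-⊕ ga gb) (Distant-tail dab)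
generators-not-pairwise-distant {a = true ∷ α} {false ∷ β} {true ∷ γ} ga gb gc _ _ dac _ =
  Constant⇒¬Distant β gb (Constant-⊕ ga gc) (Distant-tail dac)
generators-not-pairwise-distant {a = false ∷ α} {true ∷ β} {true ∷ γ} ga gb gc _ _ _ dbc =
  Constant⇒¬Distant α ga (Constant-⊕ gb gc) (Distant-tail dbc)
generators-not-pairwise-distant {a = true ∷ α} {false ∷ β} {false ∷ γ} ga gb _ gd _ _ dbc =
  Constant⇒¬Distant β gb (Constant-cancel ga gd) (Distant-tail dbc)
generators-not-pairwise-distant {a = false ∷ α} {true ∷ β} {false ∷ γ} ga gb _ gd _ dac _ =
  Constant⇒¬Distant α ga (Constant-cancel gb (subst Constant (⊕-swapˡ α β γ) gd)) (Distant-tail dac)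
generators-not-pairwise-distant {a = false ∷ α} {false ∷ β} {true ∷ γ} ga _ gc gd dab _ _ =
  Constant⇒¬Distant α ga (Constant-cancel gc (subst Constant γ-first gd)) (Distant-tail dab)
  where
  γ-first : α ⊕ (β ⊕ γ) ≡ γ ⊕ (α ⊕ β)
  γ-first = trans (cong (α ⊕_) (⊕-comm β γ)) (⊕-swapˡ α γ β)
generators-not-pairwise-distant {a = true ∷ α} {true ∷ β} {true ∷ γ} ga gb gc _ dab dac dbc =
  constants-not-pairwise-distinct ga gb gc
    (proj₁ (Distant-tail dab)) (proj₁ (Distant-tail dac)) (proj₁ (Distant-tail dbc))

module _ {n} (f : HV → Vec Bool n) (f-injective : Injective _≡_ _≡_ f)
         (f-edge : ∀ {a b} → HEdge a b → AQ-adj (f a) (f b)) where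

  private
    g : HV → Vec Bool n
    g y = f x ⊕ f y

    g-injective : ∀ {y z} → g y ≡ g z → y ≡ z
    g-injective = f-injective ∘ ⊕-injectiveˡ (f x)

    g-≢ : ∀ {y z} → y ≢ z → g y ≢ g z
    g-≢ y≢z = y≢z ∘ g-injective

    g-edge : ∀ {a b} → HEdge a b → Generator (g a ⊕ g b)
    g-edge {a} {b} e =
      subst Generator (sym (⊕-translate (f x) (f a) (f b))) (AQ-adj⇒Generator (f-edge e))

    g-edge′ : ∀ {a b} → HEdge a b → Generator (g b ⊕ g a)
    g-edge′ {a} {b} e = subst Generator (⊕-comm (g a) (g b)) (g-edge e)

    g-x : g x ≡ zeros
    g-x = ⊕-self (f x)

    x-neighbour : ∀ {y} → HEdge x y → Generator (g y)
    x-neighbour {y} e = subst Generator (trans (cong (_⊕ g y) g-x) (⊕-identityˡ (g y))) (g-edge e)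

    d w : Vec Bool n
    d = g v
    w = g u

    generator-d : Generator d
    generator-d = subst Generator (trans (cong (d ⊕_) g-x) (⊕-identityʳ d)) (g-edge vx)

    common-xv : Vec HV 4
    common-xv = x₁ ∷ x₂ ∷ x₃ ∷ x₄ ∷ []

    common-xv-adjacent : ∀ {y} → y ∈ common-xv → HEdge v y
    common-xv-adjacent (here refl)                         = vx₁
    common-xv-adjacent (there (here refl))                 = vx₂
    common-xv-adjacent (there (there (here refl)))         = vx₃
    common-xv-adjacent (there (there (there (here refl)))) = vx₄

    common-xv-unique : Unique common-xv
    common-xv-unique = ((λ ()) ∷ (λ ()) ∷ (λ ()) ∷ []) ∷ ((λ ()) ∷ (λ ()) ∷ []) ∷ ((λ ()) ∷ []) ∷ [] ∷ []

    g≢zeros : ∀ {y} → y ≢ x → g y ≢ zeros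
    g≢zeros y≢x gy≡0 = g-≢ y≢x (trans gy≡0 (sym g-x))

    not-common-with-v : ∀ {y} → ¬ HEdge v y → ¬ CommonNeighbour d (g y)
    not-common-with-v {y} ¬vy c = ¬vy (common-xv-adjacent (Any.map g-injective (Any.map⁻ gy∈)))
      where
      gy∈ : g y ∈ map g common-xv
      gy∈ = commonNeighbours-saturated {w = d} (g≢zeros {v} (λ ()))
              (Unique.map⁺ g-injective common-xv-unique)
              ((x-neighbour xx₁ , g-edge′ vx₁) ∷ (x-neighbour xx₂ , g-edge′ vx₂) ∷
               (x-neighbour xx₃ , g-edge′ vx₃) ∷ (x-neighbour xx₄ , g-edge′ vx₄) ∷ [])
              {t = g y} c

    w≢zeros : w ≢ zeros
    w≢zeros = g≢zeros {u} (λ ())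

    Distant-w : Distant w
    Distant-w = w≢zeros , λ gw → not-common-with-v (λ ()) (gw , g-edge uv)

    Distant-d⊕ : ∀ {y} → v ≢ y → ¬ HEdge v y → Generator (g y) → Distant (d ⊕ g y)
    Distant-d⊕ {y} v≢y ¬vy gy =
      g-≢ v≢y ∘ ⊕≡zeros⇒≡ ,
      λ gdy → not-common-with-v ¬vy (gy , subst Generator (⊕-comm d (g y)) gdy)

    common-xu : Vec HV 4
    common-xu = v ∷ x₅ ∷ x₆ ∷ x₇ ∷ []

    common-xu-unique : Unique common-xu
    common-xu-unique = ((λ ()) ∷ (λ ()) ∷ (λ ()) ∷ []) ∷ ((λ ()) ∷ (λ ()) ∷ []) ∷ ((λ ()) ∷ []) ∷ [] ∷ []

    partner : ∀ {y} → CommonNeighbour w (g y) → Any (λ y′ → g y ⊕ w ≡ g y′) common-xu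
    partner {y} c = Any.map⁻ (commonNeighbours-saturated w≢zeros
      (Unique.map⁺ g-injective common-xu-unique)
      ((generator-d , g-edge′ uv) ∷ (x-neighbour xx₅ , g-edge′ ux₅) ∷
       (x-neighbour xx₆ , g-edge′ ux₆) ∷ (x-neighbour xx₇ , g-edge′ ux₇) ∷ [])
      {t = g y ⊕ w} (CommonNeighbour-⊕ {w = w} {g y} c))

    no-fixed-partner : ∀ {y} → g y ⊕ w ≢ g y
    no-fixed-partner {y} e = w≢zeros (⊕-injectiveˡ (g y) (trans e (sym (⊕-identityʳ (g y)))))

    partnered⇒⊥ : ∀ {q r} → HEdge x q → HEdge x r → v ≢ q → v ≢ r → ¬ HEdge v q → ¬ HEdge v r →
                  g q ⊕ w ≡ g r → ⊥
    partnered⇒⊥ {q} {r} xq xr v≢q v≢r ¬vq ¬vr q⊕w≡r =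
      generators-not-pairwise-distant generator-d (x-neighbour xq) (x-neighbour xr)
        (subst Generator (cong (d ⊕_) (sym q⊕r≡w)) (g-edge′ uv))
        (Distant-d⊕ v≢q ¬vq (x-neighbour xq)) (Distant-d⊕ v≢r ¬vr (x-neighbour xr))
        (subst Distant (sym q⊕r≡w) Distant-w)
      where
      q⊕r≡w : g q ⊕ g r ≡ w
      q⊕r≡w = trans (cong (g q ⊕_) (sym q⊕w≡r)) (⊕-cancelˡ (g q) w)

  embedding-impossible : ⊥
  embedding-impossible with partner {x₅} (x-neighbour xx₅ , g-edge′ ux₅)
  ... | there (here 5→5)                 = no-fixed-partner 5→5
  ... | there (there (here 5→6))         = partnered⇒⊥ xx₅ xx₆ (λ ()) (λ ()) (λ ()) (λ ()) 5→6
  ... | there (there (there (here 5→7))) = partnered⇒⊥ xx₅ xx₇ (λ ()) (λ ()) (λ ()) (λ ()) 5→7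
  ... | here 5→v with partner {x₆} (x-neighbour xx₆ , g-edge′ ux₆)
  ...   | here 6→v                         = g-≢ {x₆} {x₅} (λ ()) (⊕-injectiveʳ w (trans 6→v (sym 5→v)))
  ...   | there (here 6→5)                 = g-≢ {v} {x₆} (λ ()) (trans (sym 5→v) (sym (⊕-moveʳ 6→5)))
  ...   | there (there (here 6→6))         = no-fixed-partner 6→6
  ...   | there (there (there (here 6→7))) = partnered⇒⊥ xx₆ xx₇ (λ ()) (λ ()) (λ ()) (λ ()) 6→7

lemma4p9 : (n : ℕ) → 1 ≤ n → ¬ HasSubgraphH n
lemma4p9 n _ (f , f-injective , f-edge) = embedding-impossible f f-injective f-edge
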